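{- Let $L$ be a Latin square of order $n>1$ and let $M$ be a near copy of $L$. Suppose that $S$ is a subsquare of $M$ of order $s$. Then $s\le (n+1)/2$.
   Context: A Latin square of order $n$ is an $n\times n$ matrix with rows and columns indexed by $[n]=\{1,\dots,n\}$ and symbols from $[n]$ in which each symbol occurs exactly once in each row and each column. For a cell $(i,j)$ and a symbol $\sigma\neq L[i,j]$ (where $\sigma$ may or may not lie in $[n]$), the matrix obtained from $L$ by replacing the symbol in cell $(i,j)$ by $\sigma$ is called a near copy of $L$. A subsquare of order $k$ of a matrix is a $k\times k$ submatrix (on some set of $k$ rows and $k$ columns) which is a Latin square, i.e. contains exactly $k$ distinct symbols each occurring once in each of its rows and columns. -}

module Defs where

open import Data.Nat using (ℕ; _≤_; _*_; _+_; suc)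
open import Data.Fin using (Fin; toℕ)
open import Data.Product using (Σ; ∃; _×_; _,_)
open import Relation.Binary.PropositionalEquality using (_≡_; _≢_)
open import Function.Definitions using (Injective)

-- A k×k matrix with symbols from Fin k (i.e. [k]) is a Latin square when each
-- symbol occurs exactly once in each row and each column; for a k×k array over
-- k symbols this is: every row and every column is injective.
IsLatin : (k : ℕ) → (Fin k → Fin k → Fin k) → Set
IsLatin k Q = (∀ a → Injective _≡_ _≡_ (Q a)) × (∀ b → Injective _≡_ _≡_ (λ a → Q a b))

LatinSquare : ℕ → Set
LatinSquare n = Σ (Fin n → Fin n → Fin n) (IsLatin n)

-- Symbols of general matrices live in ℕ (a near copy may use a symbol outside [n]);
-- the symbol s ∈ Fin n of L is read as the natural number toℕ s.
Matrix : ℕ → Set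
Matrix n = Fin n → Fin n → ℕ

NearCopy : {n : ℕ} → (Fin n → Fin n → Fin n) → Matrix n → Set
NearCopy {n} L M =
  Σ (Fin n) λ i → Σ (Fin n) λ j → Σ ℕ λ σ →
    (σ ≢ toℕ (L i j)) × (M i j ≡ σ) ×
    (∀ i' j' → (i' ≡ i → j' ≢ j) → M i' j' ≡ toℕ (L i' j'))

-- A subsquare of order k of M: k distinct rows R, k distinct columns C, such that
-- the k×k submatrix is a Latin square, i.e. contains exactly k distinct symbols
-- (given by an injective labelling sym : Fin k → ℕ) each occurring once in each
-- row and column (the pattern Q is a Latin square on Fin k).
Subsquare : {n : ℕ} → Matrix n → ℕ → Set
Subsquare {n} M k =
  Σ (Fin k → Fin n) λ R → Σ (Fin k → Fin n) λ C →
  Σ (Fin k → ℕ) λ sym → Σ (Fin k → Fin k → Fin k) λ Q →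
    Injective _≡_ _≡_ R × Injective _≡_ _≡_ C × Injective _≡_ _≡_ sym ×
    IsLatin k Q × (∀ a b → M (R a) (C b) ≡ sym (Q a b))

-- If the altered cell (i, j) lies outside the rows (or the columns) of the
-- subsquare S, then S is a subsquare of L itself missing some row x of L.  Every
-- symbol of a row of S reappears in each column of S, hence not in row x there;
-- so one row of S and row x show 2s distinct symbols on the columns of S.
--
-- Otherwise the new symbol σ of cell (i, j) also sits in another row of S, at a
-- cell where M agrees with L, so σ is a symbol of L; let r be its row in column j
-- of L.  Within the rows of S, column j of L avoids σ (at (i, j) because σ is
-- new, elsewhere because σ occurs once in that column of S).  Hence a symbol of
-- another row of S cannot appear in row r on a column of S other than j, and
-- these s + (s − 1) symbols are distinct: 2s − 1 ≤ n.
module Submission where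

open import Defs
open import Data.Nat using (ℕ; zero; suc; pred; _+_; _*_; _≤_; _<_; z≤n; s≤s)
open import Data.Nat.Properties
  using (1+n≰n; +-identityʳ; +-suc; +-comm; +-monoʳ-≤; pred[n]≤n; ≤-trans; module ≤-Reasoning)
open import Data.Fin using (Fin; toℕ; punchIn; punchOut) renaming (zero to 0F)
open import Data.Fin.Properties
  using ( _≟_; any?; injective⇒≤; toℕ-injective; toℕ<n; +↔⊎
        ; punchIn-injective; punchInᵢ≢i; punchOut-injective)
open import Data.Product using (∃; _,_; proj₁; proj₂)
open import Data.Sum using (_⊎_; inj₁; inj₂; [_,_]′)
open import Function using (_∘_; flip)
open import Function.Bundles using (Injection)
open import Function.Definitions using (Injective)
open import Function.Properties.Inverse using (↔⇒↣)
open import Relation.Nullary using (yes; no; contradiction)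
open import Relation.Binary.PropositionalEquality using (_≡_; _≢_; refl; sym; trans; cong)

injective⇒surjective : ∀ {n} {f : Fin n → Fin n} → Injective _≡_ _≡_ f →
                       ∀ y → ∃ λ x → f x ≡ y
injective⇒surjective {suc n} {f} f-injective y with any? (λ x → f x ≟ y)
... | yes hit = hit
... | no miss = contradiction (injective⇒≤ punchOut∘f-injective) 1+n≰n
  where
  y≢f : ∀ x → y ≢ f x
  y≢f x y≡fx = miss (x , sym y≡fx)

  punchOut∘f-injective : Injective _≡_ _≡_ (λ x → punchOut (y≢f x))
  punchOut∘f-injective = f-injective ∘ punchOut-injective (y≢f _) (y≢f _)

disjoint-injections⇒+≤ : ∀ {s t n} {f : Fin s → Fin n} {g : Fin t → Fin n} →
                         Injective _≡_ _≡_ f → Injective _≡_ _≡_ g → (∀ a b → f a ≢ g b) →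
                         s + t ≤ n
disjoint-injections⇒+≤ {s} {t} {f = f} {g} f-injective g-injective disjoint =
  injective⇒≤ (Injection.injective (↔⇒↣ (+↔⊎ {s} {t})) ∘ [f,g]-injective)
  where
  [f,g]-injective : Injective _≡_ _≡_ [ f , g ]′
  [f,g]-injective {inj₁ a} {inj₁ a′} e = cong inj₁ (f-injective e)
  [f,g]-injective {inj₁ a} {inj₂ b′} e = contradiction e (disjoint a b′)
  [f,g]-injective {inj₂ b} {inj₁ a′} e = contradiction (sym e) (disjoint a′ b)
  [f,g]-injective {inj₂ b} {inj₂ b′} e = cong inj₂ (g-injective e)

IsLatin-transpose : ∀ {k} {Q : Fin k → Fin k → Fin k} → IsLatin k Q → IsLatin k (flip Q)
IsLatin-transpose (rows , columns) = columns , rows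

IsLatin-row-surjective : ∀ {k} {Q : Fin k → Fin k → Fin k} → IsLatin k Q →
                         ∀ a y → ∃ λ b → Q a b ≡ y
IsLatin-row-surjective (rows , _) a = injective⇒surjective (rows a)

IsLatin-column-surjective : ∀ {k} {Q : Fin k → Fin k → Fin k} → IsLatin k Q →
                            ∀ b y → ∃ λ a → Q a b ≡ y
IsLatin-column-surjective (_ , columns) b = injective⇒surjective (columns b)

labels⇒≡ : ∀ {n k} (label : Fin k → ℕ) {x y : Fin n} {p q : Fin k} →
           toℕ x ≡ label p → toℕ y ≡ label q → p ≡ q → x ≡ y
labels⇒≡ _ x≡p y≡q refl = toℕ-injective (trans x≡p (sym y≡q))

subsquare-missing-row⇒+≤ :
  ∀ {n s} {L : Fin n → Fin n → Fin n} {R C : Fin s → Fin n}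
    {label : Fin s → ℕ} {Q : Fin s → Fin s → Fin s} →
  IsLatin n L → Injective _≡_ _≡_ C → IsLatin s Q →
  (∀ a b → toℕ (L (R a) (C b)) ≡ label (Q a b)) →
  (x : Fin n) → (∀ a → R a ≢ x) → s + s ≤ n
subsquare-missing-row⇒+≤ {s = zero} _ _ _ _ _ _ = z≤n
subsquare-missing-row⇒+≤ {s = suc _} {L} {R} {C} {label} {Q}
  (L-rows , L-columns) C-injective Q-latin agree x x∉R =
  disjoint-injections⇒+≤ (C-injective ∘ L-rows (R 0F)) (C-injective ∘ L-rows x) disjoint
  where
  disjoint : ∀ b b′ → L (R 0F) (C b) ≢ L x (C b′)
  disjoint b b′ e with a , Qab′≡Q0b ← IsLatin-column-surjective Q-latin b′ (Q 0F b) =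
    x∉R a (L-columns (C b′) (trans (labels⇒≡ label (agree a b′) (agree 0F b) Qab′≡Q0b) e))

subsquare-with-one-wrong-cell⇒+pred≤ :
  ∀ {n s} {L : Fin n → Fin n → Fin n} {R C : Fin s → Fin n}
    {label : Fin s → ℕ} {Q : Fin s → Fin s → Fin s} →
  IsLatin n L → Injective _≡_ _≡_ C → Injective _≡_ _≡_ label → IsLatin s Q →
  (a₀ b₀ : Fin s) → label (Q a₀ b₀) ≢ toℕ (L (R a₀) (C b₀)) →
  (∀ a b → a ≢ a₀ ⊎ b ≢ b₀ → toℕ (L (R a) (C b)) ≡ label (Q a b)) →
  s + pred s ≤ n
subsquare-with-one-wrong-cell⇒+pred≤ {s = suc zero} {C = C} _ _ _ _ _ _ _ _ =
  ≤-trans (s≤s z≤n) (toℕ<n (C 0F))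
subsquare-with-one-wrong-cell⇒+pred≤ {n} {suc (suc t)} {L} {R} {C} {label} {Q}
  (L-rows , L-columns) C-injective label-injective Q-latin a₀ b₀ wrong agree =
  disjoint-injections⇒+≤ (C-injective ∘ L-rows (R a₁))
                         (punchIn-injective b₀ _ _ ∘ C-injective ∘ L-rows r) disjoint
  where
  a₁ : Fin (suc (suc t))
  a₁ = punchIn a₀ 0F

  agree-a₁ : ∀ b → toℕ (L (R a₁) (C b)) ≡ label (Q a₁ b)
  agree-a₁ b = agree a₁ b (inj₁ (punchInᵢ≢i a₀ 0F))

  b₁-hit : ∃ λ b → Q a₁ b ≡ Q a₀ b₀
  b₁-hit = IsLatin-row-surjective Q-latin a₁ (Q a₀ b₀)

  σ : Fin n
  σ = L (R a₁) (C (proj₁ b₁-hit))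

  σ-label : toℕ σ ≡ label (Q a₀ b₀)
  σ-label = trans (agree-a₁ (proj₁ b₁-hit)) (cong label (proj₂ b₁-hit))

  r-hit : ∃ λ x → L x (C b₀) ≡ σ
  r-hit = injective⇒surjective (L-columns (C b₀)) σ

  r : Fin n
  r = proj₁ r-hit

  σ∉column : ∀ a → L (R a) (C b₀) ≢ σ
  σ∉column a e with a ≟ a₀
  ... | yes refl = wrong (sym (trans (cong toℕ e) σ-label))
  ... | no a≢a₀ = a≢a₀ (proj₂ Q-latin b₀ (label-injective
                    (trans (sym (agree a b₀ (inj₁ a≢a₀))) (trans (cong toℕ e) σ-label))))

  disjoint : ∀ b b′ → L (R a₁) (C b) ≢ L r (C (punchIn b₀ b′))
  disjoint b b′ e with a , Qab′≡Qa₁b ← IsLatin-column-surjective Q-latin (punchIn b₀ b′) (Q a₁ b) =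
    σ∉column a (trans (cong (λ x → L x (C b₀)) Ra≡r) (proj₂ r-hit))
    where
    Ra≡r : R a ≡ r
    Ra≡r = L-columns (C (punchIn b₀ b′))
             (trans (labels⇒≡ label (agree a _ (inj₂ (punchInᵢ≢i b₀ b′))) (agree-a₁ b) Qab′≡Qa₁b) e)

+pred≤⇒2*≤+1 : ∀ s {n} → s + pred s ≤ n → 2 * s ≤ n + 1
+pred≤⇒2*≤+1 zero    _ = z≤n
+pred≤⇒2*≤+1 (suc s) {n} bound = begin
  2 * suc s          ≡⟨ cong (suc s +_) (+-identityʳ (suc s)) ⟩
  suc s + suc s      ≡⟨ +-suc (suc s) s ⟩
  suc (suc s + s)    ≤⟨ s≤s bound ⟩
  suc n              ≡⟨ +-comm 1 n ⟩
  n + 1              ∎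
  where open ≤-Reasoning

+≤⇒+pred≤ : ∀ s {n} → s + s ≤ n → s + pred s ≤ n
+≤⇒+pred≤ s = ≤-trans (+-monoʳ-≤ s pred[n]≤n)

lemma2p1 : (n : ℕ) → 1 < n → (L : LatinSquare n) → (M : Matrix n) → NearCopy (proj₁ L) M → (s : ℕ) → Subsquare M s → 2 * s ≤ n + 1
lemma2p1 n _ (L , L-latin) M (i , j , σ , σ≢Lij , Mij≡σ , M≡L) s
  (R , C , label , Q , R-injective , C-injective , label-injective , Q-latin , M≡S)
  with any? (λ a → R a ≟ i) | any? (λ b → C b ≟ j)
... | no i∉R | _ =
  +pred≤⇒2*≤+1 s (+≤⇒+pred≤ s
    (subsquare-missing-row⇒+≤ {R = R} {label = label} L-latin C-injective Q-latin
      (λ a b → trans (sym (M≡L _ _ (λ Ra≡i → contradiction (a , Ra≡i) i∉R))) (M≡S a b))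
      i (λ a Ra≡i → i∉R (a , Ra≡i))))
... | yes _ | no j∉C =
  +pred≤⇒2*≤+1 s (+≤⇒+pred≤ s
    (subsquare-missing-row⇒+≤ {R = C} {label = label}
      (IsLatin-transpose L-latin) R-injective (IsLatin-transpose Q-latin)
      (λ b a → trans (sym (M≡L _ _ (λ _ Cb≡j → j∉C (b , Cb≡j)))) (M≡S a b))
      j (λ b Cb≡j → j∉C (b , Cb≡j))))
... | yes (a₀ , refl) | yes (b₀ , refl) =
  +pred≤⇒2*≤+1 s
    (subsquare-with-one-wrong-cell⇒+pred≤ {R = R} L-latin C-injective label-injective Q-latin a₀ b₀
      (λ e → σ≢Lij (trans (sym Mij≡σ) (trans (M≡S a₀ b₀) e)))
      (λ a b off → trans (sym (M≡L _ _ (outside off))) (M≡S a b)))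
  where
  outside : ∀ {a b} → a ≢ a₀ ⊎ b ≢ b₀ → R a ≡ R a₀ → C b ≢ C b₀
  outside (inj₁ a≢a₀) Ra≡Ra₀ _ = a≢a₀ (R-injective Ra≡Ra₀)
  outside (inj₂ b≢b₀) _ Cb≡Cb₀ = b≢b₀ (C-injective Cb≡Cb₀)
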